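{- Let $\{x_n\}_{n\in\mathbb{Z}}$, $\{y_n\}_{n\in\mathbb{Z}}$, $\{t_n\}_{n\in\mathbb{Z}}$ be sequences of complex numbers with $x_n\neq0$, $y_n\neq 0$ for all $n$. Let $\{\alpha_{k,n}\}_{k,n\in\mathbb{Z}}$ and $\{\beta_{k,n}\}_{k,n\in\mathbb{Z}}$ be double-indexed sequences with $$\alpha_{k,n}=\frac{\prod_{i=1}^{n}x_i}{\prod_{i=1}^{k}y_i},\qquad \beta_{n-1,n}=t_n,\qquad \beta_{k,n}=-\beta_{n,k}$$ for all integers $k,n$. Then $$\alpha_{n,p}\beta_{q,k}+\alpha_{n,q}\beta_{k,p}+\alpha_{n,k}\beta_{p,q}=0\quad\text{for all integers }n,k,p,q$$ holds if and only if, for all integers $k\le n$, $$\beta_{k,n}=\sum_{i=k+1}^{n}t_i\,\frac{\prod_{j=i+1}^{n}x_j}{\prod_{j=k+1}^{i-1}x_j}.$$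
   Context: Products over integer ranges follow the convention: $\prod_{i=k}^{n}c_i=c_kc_{k+1}\cdots c_n$ if $n\ge k$; $=1$ if $n=k-1$; $=1/(c_{n+1}c_{n+2}\cdots c_{k-1})$ if $n\le k-2$. Empty sums equal $0$. -}

module Defs where

open import Level using (Level; suc; _⊔_)
open import Algebra.Bundles using (CommutativeRing)
open import Data.Nat as ℕ using (ℕ)
open import Data.Integer as ℤ using (ℤ; +_; -[1+_]; 1ℤ)
open import Relation.Nullary using (¬_)

-- A field: a commutative ring with 0 ≉ 1 and a multiplicative inverse
-- for every nonzero element (inverse of 0 is an arbitrary junk value).
record Field (c ℓ : Level) : Set (suc (c ⊔ ℓ)) where
  field
    commutativeRing : CommutativeRing c ℓ
  open CommutativeRing commutativeRing public
  field
    _⁻¹       : Carrier → Carrier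
    0≉1       : ¬ (0# ≈ 1#)
    inverseʳ  : ∀ x → ¬ (x ≈ 0#) → (x * (x ⁻¹)) ≈ 1#

module _ {c ℓ} (F : Field c ℓ) where
  open Field F

  prodFrom : (ℤ → Carrier) → ℤ → ℕ → Carrier
  prodFrom f a ℕ.zero    = 1#
  prodFrom f a (ℕ.suc m) = f a * prodFrom f (a ℤ.+ 1ℤ) m

  -- ∏_{i=k}^{n} c_i with the paper's convention:
  --   n ≥ k     : c_k ⋯ c_n
  --   n = k - 1 : 1
  --   n ≤ k - 2 : 1 / (c_{n+1} ⋯ c_{k-1})
  prodRange : (ℤ → Carrier) → ℤ → ℤ → Carrier
  prodRange f k n with n ℤ.- k ℤ.+ 1ℤ
  ... | + m      = prodFrom f k m
  ... | -[1+ m ] = (prodFrom f (n ℤ.+ 1ℤ) (ℕ.suc m)) ⁻¹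

  sumFrom : (ℤ → Carrier) → ℤ → ℕ → Carrier
  sumFrom f a ℕ.zero    = 0#
  sumFrom f a (ℕ.suc m) = f a + sumFrom f (a ℤ.+ 1ℤ) m

  sumRange : (ℤ → Carrier) → ℤ → ℤ → Carrier
  sumRange f k n with n ℤ.- k ℤ.+ 1ℤ
  ... | + m      = sumFrom f k m
  ... | -[1+ m ] = 0#

module Submission where

-- Write X n = ∏_{i=1}^{n} x_i, so that α n p = X p / Y n, and rescale
-- γ k n = β k n / (X k X n).  Clearing the nonzero factors 1 / Y n and X k X p X q,
-- the cyclic identity becomes the cocycle condition γ q k + γ k p + γ p q = 0.
-- For antisymmetric γ this says exactly that γ k n = E n - E k for some E : ℤ → F,
-- i.e. that γ k n telescopes into its steps γ (i - 1) i.  The paper's convention for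
-- products with n < k is what makes ∏_{i=a+1}^{b} x_i = X b / X a for all integers
-- a and b, and multiplying the telescoped sum back by X k X n gives the stated
-- formula for β.

open import Defs
open import Level using (Level)
open import Data.Integer as ℤ using (ℤ; 1ℤ)
open import Data.Product using (_×_)
open import Relation.Nullary using (¬_)

open import Data.Nat using (zero; suc)
import Data.Nat.Properties as ℕP
open import Data.Integer using (+_; -[1+_]; 0ℤ)
import Data.Integer.Properties as ℤP
open import Data.Integer.Tactic.RingSolver using (solve-∀)
open import Data.Product using (_,_; ∃; <_,_>)
open import Data.Sum using (inj₁; inj₂)
open import Function.Bundles using (_⇔_; mk⇔; module Equivalence)
import Function.Properties.Equivalence as ⇔
open import Relation.Binary.PropositionalEquality as ≡ using (_≡_)
import Relation.Binary.Reasoning.Setoid as SetoidReasoning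

module FieldProperties {c ℓ} (F : Field c ℓ) where
  open Field F
  open SetoidReasoning setoid
  open import Algebra.Solver.Ring.NaturalCoefficients.Default commutativeSemiring

  inverseˡ : ∀ x → x ≉ 0# → x ⁻¹ * x ≈ 1#
  inverseˡ x x≉0 = trans (*-comm _ _) (inverseʳ x x≉0)

  *-cancelˡ : ∀ {z u v} → z ≉ 0# → z * u ≈ z * v → u ≈ v
  *-cancelˡ {z} {u} {v} z≉0 zu≈zv = begin
    u               ≈⟨ z⁻¹*[z*w]≈w u ⟨
    z ⁻¹ * (z * u)  ≈⟨ *-congˡ zu≈zv ⟩
    z ⁻¹ * (z * v)  ≈⟨ z⁻¹*[z*w]≈w v ⟩
    v               ∎
    where
    z⁻¹*[z*w]≈w : ∀ w → z ⁻¹ * (z * w) ≈ w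
    z⁻¹*[z*w]≈w w = trans (sym (*-assoc _ _ _)) (trans (*-congʳ (inverseˡ z z≉0)) (*-identityˡ w))

  *-≉0 : ∀ {a b} → a ≉ 0# → b ≉ 0# → a * b ≉ 0#
  *-≉0 {a} {b} a≉0 b≉0 ab≈0 = b≉0 (*-cancelˡ a≉0 (trans ab≈0 (sym (zeroʳ a))))

  1≉0 : 1# ≉ 0#
  1≉0 1≈0 = 0≉1 (sym 1≈0)

  ⁻¹-≉0 : ∀ {a} → a ≉ 0# → a ⁻¹ ≉ 0#
  ⁻¹-≉0 {a} a≉0 a⁻¹≈0 = 0≉1 (begin
    0#          ≈⟨ zeroʳ a ⟨
    a * 0#      ≈⟨ *-congˡ a⁻¹≈0 ⟨
    a * a ⁻¹    ≈⟨ inverseʳ a a≉0 ⟩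
    1#          ∎)

  inverseʳ-unique : ∀ {x y} → x * y ≈ 1# → y ≈ x ⁻¹
  inverseʳ-unique {x} {y} xy≈1 = *-cancelˡ x≉0 (trans xy≈1 (sym (inverseʳ x x≉0)))
    where
    x≉0 : x ≉ 0#
    x≉0 x≈0 = 0≉1 (trans (sym (trans (*-congʳ x≈0) (zeroˡ y))) xy≈1)

  x*y≈z⇒x≈z*y⁻¹ : ∀ {x y z} → y ≉ 0# → x * y ≈ z → x ≈ z * y ⁻¹
  x*y≈z⇒x≈z*y⁻¹ {x} {y} {z} y≉0 xy≈z = begin
    x                  ≈⟨ *-identityʳ x ⟨
    x * 1#             ≈⟨ *-congˡ (inverseʳ y y≉0) ⟨
    x * (y * y ⁻¹)     ≈⟨ *-assoc x y (y ⁻¹) ⟨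
    (x * y) * y ⁻¹     ≈⟨ *-congʳ xy≈z ⟩
    z * y ⁻¹           ∎

  x*y≈z⇒x⁻¹≈y*z⁻¹ : ∀ {x y z} → z ≉ 0# → x * y ≈ z → x ⁻¹ ≈ y * z ⁻¹
  x*y≈z⇒x⁻¹≈y*z⁻¹ {x} {y} {z} z≉0 xy≈z = sym (inverseʳ-unique (begin
    x * (y * z ⁻¹)     ≈⟨ *-assoc x y (z ⁻¹) ⟨
    (x * y) * z ⁻¹     ≈⟨ *-congʳ xy≈z ⟩
    z * z ⁻¹           ≈⟨ inverseʳ z z≉0 ⟩
    1#                 ∎))

  x*y*y⁻¹≈x : ∀ x {y} → y ≉ 0# → x * y * y ⁻¹ ≈ x
  x*y*y⁻¹≈x x {y} y≉0 = sym (x*y≈z⇒x≈z*y⁻¹ y≉0 refl)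

  [x*y]⁻¹*x≈y⁻¹ : ∀ {x y} → x ≉ 0# → y ≉ 0# → (x * y) ⁻¹ * x ≈ y ⁻¹
  [x*y]⁻¹*x≈y⁻¹ {x} {y} x≉0 y≉0 = inverseʳ-unique (begin
    y * ((x * y) ⁻¹ * x)   ≈⟨ solve 3 (λ x y w → y :* (w :* x) := x :* y :* w) refl x y ((x * y) ⁻¹) ⟩
    (x * y) * (x * y) ⁻¹   ≈⟨ inverseʳ (x * y) (*-≉0 x≉0 y≉0) ⟩
    1#                     ∎)

  1⁻¹≈1 : 1# ⁻¹ ≈ 1#
  1⁻¹≈1 = sym (inverseʳ-unique (*-identityˡ 1#))

≤⇒≡+ : ∀ {k n} → k ℤ.≤ n → ∃ λ m → n ≡ k ℤ.+ + m
≤⇒≡+ {k} {n} k≤n = ℤ.∣ n ℤ.- k ∣ , (begin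
  n                      ≡⟨ n≡k+[n-k] n k ⟩
  k ℤ.+ (n ℤ.- k)        ≡⟨ ≡.cong (λ j → k ℤ.+ j) 0≤n-k ⟨
  k ℤ.+ + ℤ.∣ n ℤ.- k ∣  ∎)
  where
  open ≡.≡-Reasoning
  n≡k+[n-k] : ∀ n k → n ≡ k ℤ.+ (n ℤ.- k)
  n≡k+[n-k] = solve-∀
  0≤n-k : + ℤ.∣ n ℤ.- k ∣ ≡ n ℤ.- k
  0≤n-k = ℤP.0≤i⇒+∣i∣≡i (ℤP.i≤j⇒0≤j-i k≤n)

module Ranges {c ℓ} (F : Field c ℓ) where
  open Field F hiding (zero)
  open FieldProperties F
  open SetoidReasoning setoid

  sumRange-+ : ∀ f k n {m} → n ℤ.- k ℤ.+ 1ℤ ≡ + m → sumRange F f k n ≡ sumFrom F f k m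
  sumRange-+ f k n eq with n ℤ.- k ℤ.+ 1ℤ
  sumRange-+ f k n ≡.refl | _ = ≡.refl

  prodRange-+ : ∀ f k n {m} → n ℤ.- k ℤ.+ 1ℤ ≡ + m → prodRange F f k n ≡ prodFrom F f k m
  prodRange-+ f k n eq with n ℤ.- k ℤ.+ 1ℤ
  prodRange-+ f k n ≡.refl | _ = ≡.refl

  prodRange-[1+] : ∀ f k n {m} → n ℤ.- k ℤ.+ 1ℤ ≡ -[1+ m ] →
                   prodRange F f k n ≡ prodFrom F f (n ℤ.+ 1ℤ) (suc m) ⁻¹
  prodRange-[1+] f k n eq with n ℤ.- k ℤ.+ 1ℤ
  prodRange-[1+] f k n ≡.refl | _ = ≡.refl

  sumFrom-cong : ∀ {f g} → (∀ i → f i ≈ g i) → ∀ a m → sumFrom F f a m ≈ sumFrom F g a m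
  sumFrom-cong f≈g a zero    = refl
  sumFrom-cong f≈g a (suc m) = +-cong (f≈g a) (sumFrom-cong f≈g (a ℤ.+ 1ℤ) m)

  sumRange-cong : ∀ {f g} → (∀ i → f i ≈ g i) → ∀ k n → sumRange F f k n ≈ sumRange F g k n
  sumRange-cong f≈g k n with n ℤ.- k ℤ.+ 1ℤ
  ... | + m      = sumFrom-cong f≈g k m
  ... | -[1+ m ] = refl

  sumFrom-*ˡ : ∀ z f a m → sumFrom F (λ i → z * f i) a m ≈ z * sumFrom F f a m
  sumFrom-*ˡ z f a zero    = sym (zeroʳ z)
  sumFrom-*ˡ z f a (suc m) =
    trans (+-congˡ (sumFrom-*ˡ z f (a ℤ.+ 1ℤ) m)) (sym (distribˡ z _ _))

  sumRange-*ˡ : ∀ z f k n → sumRange F (λ i → z * f i) k n ≈ z * sumRange F f k n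
  sumRange-*ˡ z f k n with n ℤ.- k ℤ.+ 1ℤ
  ... | + m      = sumFrom-*ˡ z f k m
  ... | -[1+ m ] = sym (zeroʳ z)

  prodFrom-≉0 : ∀ {f} → (∀ i → f i ≉ 0#) → ∀ a m → prodFrom F f a m ≉ 0#
  prodFrom-≉0 f≉0 a zero    = 1≉0
  prodFrom-≉0 f≉0 a (suc m) = *-≉0 (f≉0 a) (prodFrom-≉0 f≉0 (a ℤ.+ 1ℤ) m)

  prodRange-≉0 : ∀ {f} → (∀ i → f i ≉ 0#) → ∀ k n → prodRange F f k n ≉ 0#
  prodRange-≉0 f≉0 k n with n ℤ.- k ℤ.+ 1ℤ
  ... | + m      = prodFrom-≉0 f≉0 k m
  ... | -[1+ m ] = ⁻¹-≉0 (prodFrom-≉0 f≉0 (n ℤ.+ 1ℤ) (suc m))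

  Antidifference : (Carrier → Carrier → Carrier) → (d E : ℤ → Carrier) → Set ℓ
  Antidifference _∙_ d E = ∀ i → E i ∙ d (i ℤ.+ 1ℤ) ≈ E (i ℤ.+ 1ℤ)

  +1+ : ∀ a m → (a ℤ.+ 1ℤ) ℤ.+ + m ≡ a ℤ.+ + suc m
  +1+ a m = ℤP.+-assoc a 1ℤ (+ m)

  length-+1 : ∀ k n {i} → n ℤ.- k ℤ.+ 1ℤ ≡ i → n ℤ.+ 1ℤ ℤ.- k ℤ.+ 1ℤ ≡ i ℤ.+ 1ℤ
  length-+1 k n ≡.refl = [n+1]-k+1≡[n-k+1]+1 k n
    where
    [n+1]-k+1≡[n-k+1]+1 : ∀ k n → n ℤ.+ 1ℤ ℤ.- k ℤ.+ 1ℤ ≡ n ℤ.- k ℤ.+ 1ℤ ℤ.+ 1ℤ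
    [n+1]-k+1≡[n-k+1]+1 = solve-∀

  end+1≡start+length : ∀ k n → n ℤ.+ 1ℤ ≡ k ℤ.+ (n ℤ.- k ℤ.+ 1ℤ)
  end+1≡start+length = solve-∀

  end≡start+length : ∀ a b → b ≡ a ℤ.+ (b ℤ.- (a ℤ.+ 1ℤ) ℤ.+ 1ℤ)
  end≡start+length = solve-∀

  start≡end-length : ∀ a b → a ≡ b ℤ.- (b ℤ.- (a ℤ.+ 1ℤ) ℤ.+ 1ℤ)
  start≡end-length = solve-∀

  length-of-+ : ∀ k j → k ℤ.+ j ℤ.- (k ℤ.+ 1ℤ) ℤ.+ 1ℤ ≡ j
  length-of-+ = solve-∀

  sumFrom-antidifference : ∀ {d E} → Antidifference _+_ d E →
                           ∀ a m → E a + sumFrom F d (a ℤ.+ 1ℤ) m ≈ E (a ℤ.+ + m)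
  sumFrom-antidifference {d} {E} E′ a zero =
    trans (+-identityʳ (E a)) (reflexive (≡.cong E (≡.sym (ℤP.+-identityʳ a))))
  sumFrom-antidifference {d} {E} E′ a (suc m) = begin
    E a + (d (a ℤ.+ 1ℤ) + sumFrom F d (a ℤ.+ 1ℤ ℤ.+ 1ℤ) m)  ≈⟨ +-assoc _ _ _ ⟨
    E a + d (a ℤ.+ 1ℤ) + sumFrom F d (a ℤ.+ 1ℤ ℤ.+ 1ℤ) m    ≈⟨ +-congʳ (E′ a) ⟩
    E (a ℤ.+ 1ℤ) + sumFrom F d (a ℤ.+ 1ℤ ℤ.+ 1ℤ) m          ≈⟨ sumFrom-antidifference E′ _ m ⟩
    E (a ℤ.+ 1ℤ ℤ.+ + m)                                   ≡⟨ ≡.cong E (+1+ a m) ⟩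
    E (a ℤ.+ + suc m)                                      ∎

  prodFrom-antidifference : ∀ {f P} → Antidifference _*_ f P →
                            ∀ a m → P a * prodFrom F f (a ℤ.+ 1ℤ) m ≈ P (a ℤ.+ + m)
  prodFrom-antidifference {f} {P} P′ a zero =
    trans (*-identityʳ (P a)) (reflexive (≡.cong P (≡.sym (ℤP.+-identityʳ a))))
  prodFrom-antidifference {f} {P} P′ a (suc m) = begin
    P a * (f (a ℤ.+ 1ℤ) * prodFrom F f (a ℤ.+ 1ℤ ℤ.+ 1ℤ) m)  ≈⟨ *-assoc _ _ _ ⟨
    P a * f (a ℤ.+ 1ℤ) * prodFrom F f (a ℤ.+ 1ℤ ℤ.+ 1ℤ) m    ≈⟨ *-congʳ (P′ a) ⟩
    P (a ℤ.+ 1ℤ) * prodFrom F f (a ℤ.+ 1ℤ ℤ.+ 1ℤ) m          ≈⟨ prodFrom-antidifference P′ _ m ⟩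
    P (a ℤ.+ 1ℤ ℤ.+ + m)                                    ≡⟨ ≡.cong P (+1+ a m) ⟩
    P (a ℤ.+ + suc m)                                       ∎

  prodFrom-snoc : ∀ f a m → prodFrom F f a m * f (a ℤ.+ + m) ≈ prodFrom F f a (suc m)
  prodFrom-snoc f a zero    =
    trans (*-comm 1# _) (*-congʳ (reflexive (≡.cong f (ℤP.+-identityʳ a))))
  prodFrom-snoc f a (suc m) = begin
    f a * prodFrom F f (a ℤ.+ 1ℤ) m * f (a ℤ.+ + suc m)
      ≈⟨ *-assoc _ _ _ ⟩
    f a * (prodFrom F f (a ℤ.+ 1ℤ) m * f (a ℤ.+ + suc m))
      ≈⟨ *-congˡ (*-congˡ (reflexive (≡.cong f (+1+ a m)))) ⟨
    f a * (prodFrom F f (a ℤ.+ 1ℤ) m * f (a ℤ.+ 1ℤ ℤ.+ + m))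
      ≈⟨ *-congˡ (prodFrom-snoc f (a ℤ.+ 1ℤ) m) ⟩
    f a * prodFrom F f (a ℤ.+ 1ℤ) (suc m) ∎

  prodRange-antidifference : ∀ {f} → (∀ i → f i ≉ 0#) → ∀ k →
                             Antidifference _*_ f (prodRange F f k)
  prodRange-antidifference {f} f≉0 k n with n ℤ.- k ℤ.+ 1ℤ in eq
  ... | + m = begin
    prodFrom F f k m * f (n ℤ.+ 1ℤ)   ≈⟨ *-congˡ (reflexive (≡.cong f n+1≡k+m)) ⟩
    prodFrom F f k m * f (k ℤ.+ + m)  ≈⟨ prodFrom-snoc f k m ⟩
    prodFrom F f k (suc m)            ≡⟨ prodRange-+ f k (n ℤ.+ 1ℤ) length≡1+m ⟨
    prodRange F f k (n ℤ.+ 1ℤ)        ∎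
    where
    n+1≡k+m : n ℤ.+ 1ℤ ≡ k ℤ.+ + m
    n+1≡k+m = ≡.trans (end+1≡start+length k n) (≡.cong (λ j → k ℤ.+ j) eq)
    length≡1+m : n ℤ.+ 1ℤ ℤ.- k ℤ.+ 1ℤ ≡ + suc m
    length≡1+m = ≡.trans (length-+1 k n eq) (ℤP.+-comm (+ m) 1ℤ)
  ... | -[1+ zero ] = begin
    (f (n ℤ.+ 1ℤ) * 1#) ⁻¹ * f (n ℤ.+ 1ℤ)  ≈⟨ [x*y]⁻¹*x≈y⁻¹ (f≉0 _) 1≉0 ⟩
    1# ⁻¹                                   ≈⟨ 1⁻¹≈1 ⟩
    1#                                      ≡⟨ prodRange-+ f k (n ℤ.+ 1ℤ) (length-+1 k n eq) ⟨
    prodRange F f k (n ℤ.+ 1ℤ)              ∎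
  ... | -[1+ suc m ] = begin
    (f (n ℤ.+ 1ℤ) * Q) ⁻¹ * f (n ℤ.+ 1ℤ)  ≈⟨ [x*y]⁻¹*x≈y⁻¹ (f≉0 _) (prodFrom-≉0 f≉0 _ (suc m)) ⟩
    Q ⁻¹                                   ≡⟨ prodRange-[1+] f k (n ℤ.+ 1ℤ) (length-+1 k n eq) ⟨
    prodRange F f k (n ℤ.+ 1ℤ)             ∎
    where
    Q : Carrier
    Q = prodFrom F f (n ℤ.+ 1ℤ ℤ.+ 1ℤ) (suc m)

  prodRange-split : ∀ {f} → (∀ i → f i ≉ 0#) → ∀ k a b →
                    prodRange F f k a * prodRange F f (a ℤ.+ 1ℤ) b ≈ prodRange F f k b
  prodRange-split {f} f≉0 k a b with b ℤ.- (a ℤ.+ 1ℤ) ℤ.+ 1ℤ in eq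
  ... | + m = begin
    prodRange F f k a * prodFrom F f (a ℤ.+ 1ℤ) m
      ≈⟨ prodFrom-antidifference (prodRange-antidifference f≉0 k) a m ⟩
    prodRange F f k (a ℤ.+ + m)
      ≡⟨ ≡.cong (prodRange F f k) (≡.trans (end≡start+length a b) (≡.cong (λ j → a ℤ.+ j) eq)) ⟨
    prodRange F f k b ∎
  ... | -[1+ m ] = begin
    prodRange F f k a * Q ⁻¹
      ≡⟨ ≡.cong (λ j → prodRange F f k j * Q ⁻¹)
                (≡.trans (start≡end-length a b) (≡.cong (λ j → b ℤ.- j) eq)) ⟩
    prodRange F f k (b ℤ.+ + suc m) * Q ⁻¹
      ≈⟨ *-congʳ (prodFrom-antidifference (prodRange-antidifference f≉0 k) b (suc m)) ⟨
    prodRange F f k b * Q * Q ⁻¹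
      ≈⟨ x*y*y⁻¹≈x (prodRange F f k b) (prodFrom-≉0 f≉0 (b ℤ.+ 1ℤ) (suc m)) ⟩
    prodRange F f k b ∎
    where
    Q : Carrier
    Q = prodFrom F f (b ℤ.+ 1ℤ) (suc m)

  antidifference : (ℤ → Carrier) → ℤ → Carrier
  antidifference d (+ zero)      = 0#
  antidifference d (+ suc m)     = antidifference d (+ m) + d (+ suc m)
  antidifference d -[1+ zero ]   = - d (+ zero)
  antidifference d -[1+ suc m ]  = antidifference d -[1+ m ] - d -[1+ m ]

  antidifference-correct : ∀ d → Antidifference _+_ d (antidifference d)
  antidifference-correct d (+ m) rewrite ℕP.+-comm m 1 = refl
  antidifference-correct d -[1+ zero ]  = -‿inverseˡ (d (+ zero))
  antidifference-correct d -[1+ suc m ] =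
    trans (+-assoc _ _ _) (trans (+-congˡ (-‿inverseˡ _)) (+-identityʳ _))

  sumRange-antidifference : ∀ {d E} → Antidifference _+_ d E →
                            ∀ {k n} → k ℤ.≤ n → E k + sumRange F d (k ℤ.+ 1ℤ) n ≈ E n
  sumRange-antidifference {d} {E} E′ {k} k≤n with ≤⇒≡+ k≤n
  ... | m , ≡.refl = begin
    E k + sumRange F d (k ℤ.+ 1ℤ) (k ℤ.+ + m)
      ≈⟨ +-congˡ (reflexive (sumRange-+ d (k ℤ.+ 1ℤ) (k ℤ.+ + m) (length-of-+ k (+ m)))) ⟩
    E k + sumFrom F d (k ℤ.+ 1ℤ) m
      ≈⟨ sumFrom-antidifference E′ k m ⟩
    E (k ℤ.+ + m) ∎

module Cocycles {c ℓ} (F : Field c ℓ) where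
  open Field F hiding (zero)
  open Ranges F
  open import Algebra.Properties.Ring ring
    using (x+x≈x⇒x≈0; +-inverseˡ-unique; +-identityʳ-unique)
  open SetoidReasoning setoid

  Antisymmetric : (ℤ → ℤ → Carrier) → Set ℓ
  Antisymmetric γ = ∀ k n → γ k n ≈ - γ n k

  Cocycle : (ℤ → ℤ → Carrier) → Set ℓ
  Cocycle γ = ∀ k p q → γ q k + γ k p + γ p q ≈ 0#

  Telescopes : (ℤ → ℤ → Carrier) → Set ℓ
  Telescopes γ =
    ∀ k n → k ℤ.≤ n → γ k n ≈ sumRange F (λ i → γ (i ℤ.- 1ℤ) i) (k ℤ.+ 1ℤ) n

  module _ {γ : ℤ → ℤ → Carrier} (antisym : Antisymmetric γ) where

    cocycle⇒chasles : Cocycle γ → ∀ a b c → γ a b + γ b c ≈ γ a c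
    cocycle⇒chasles cocycle a b c = begin
      γ a b + γ b c  ≈⟨ +-inverseˡ-unique _ _ (cocycle b c a) ⟩
      - γ c a        ≈⟨ antisym a c ⟨
      γ a c          ∎

    cocycle⇒telescopes : Cocycle γ → Telescopes γ
    cocycle⇒telescopes cocycle k n k≤n = begin
      γ k n                            ≈⟨ sumRange-antidifference γₖ′ k≤n ⟨
      γ k k + sumRange F d (k ℤ.+ 1ℤ) n ≈⟨ +-congʳ (x+x≈x⇒x≈0 (γ k k) (chasles k k k)) ⟩
      0# + sumRange F d (k ℤ.+ 1ℤ) n    ≈⟨ +-identityˡ _ ⟩
      sumRange F d (k ℤ.+ 1ℤ) n         ∎
      where
      chasles : ∀ a b c → γ a b + γ b c ≈ γ a c
      chasles = cocycle⇒chasles cocycle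
      d : ℤ → Carrier
      d i = γ (i ℤ.- 1ℤ) i
      +1-1 : ∀ i → i ℤ.+ 1ℤ ℤ.- 1ℤ ≡ i
      +1-1 = solve-∀
      γₖ′ : Antidifference _+_ d (γ k)
      γₖ′ i = begin
        γ k i + γ (i ℤ.+ 1ℤ ℤ.- 1ℤ) (i ℤ.+ 1ℤ)
          ≈⟨ +-congˡ (reflexive (≡.cong (λ j → γ j (i ℤ.+ 1ℤ)) (+1-1 i))) ⟩
        γ k i + γ i (i ℤ.+ 1ℤ)
          ≈⟨ chasles k i (i ℤ.+ 1ℤ) ⟩
        γ k (i ℤ.+ 1ℤ) ∎

    telescopes⇒cocycle : Telescopes γ → Cocycle γ
    telescopes⇒cocycle telescopes k p q = +-identityʳ-unique (E q) _ (begin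
      E q + (γ q k + γ k p + γ p q)    ≈⟨ +-assoc _ _ _ ⟨
      E q + (γ q k + γ k p) + γ p q    ≈⟨ +-congʳ (+-assoc _ _ _) ⟨
      E q + γ q k + γ k p + γ p q      ≈⟨ +-congʳ (+-congʳ (coboundary q k)) ⟩
      E k + γ k p + γ p q              ≈⟨ +-congʳ (coboundary k p) ⟩
      E p + γ p q                      ≈⟨ coboundary p q ⟩
      E q                              ∎)
      where
      d : ℤ → Carrier
      d i = γ (i ℤ.- 1ℤ) i
      E : ℤ → Carrier
      E = antidifference d
      E′ : Antidifference _+_ d E
      E′ = antidifference-correct d
      coboundary : ∀ k n → E k + γ k n ≈ E n
      coboundary k n with ℤP.≤-total k n
      ... | inj₁ k≤n = trans (+-congˡ (telescopes k n k≤n)) (sumRange-antidifference E′ k≤n)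
      ... | inj₂ n≤k = begin
        E k + γ k n                ≈⟨ +-cong (sym (sumRange-antidifference E′ n≤k)) (antisym k n) ⟩
        E n + S + - γ n k          ≈⟨ +-congʳ (+-congˡ (telescopes n k n≤k)) ⟨
        E n + γ n k + - γ n k      ≈⟨ +-assoc _ _ _ ⟩
        E n + (γ n k + - γ n k)    ≈⟨ +-congˡ (-‿inverseʳ _) ⟩
        E n + 0#                   ≈⟨ +-identityʳ _ ⟩
        E n                        ∎
        where
        S : Carrier
        S = sumRange F d (n ℤ.+ 1ℤ) k

    cocycle⇔telescopes : Cocycle γ ⇔ Telescopes γ
    cocycle⇔telescopes = mk⇔ cocycle⇒telescopes telescopes⇒cocycle

module Rescaling {c ℓ} (F : Field c ℓ) where
  open Field F hiding (zero)
  open FieldProperties F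
  open Ranges F
  open Cocycles F
  open import Algebra.Properties.Ring ring using (-‿distribʳ-*)
  open import Algebra.Solver.Ring.NaturalCoefficients.Default commutativeSemiring
  open SetoidReasoning setoid

  rescale : (u : ℤ → Carrier) → (ℤ → ℤ → Carrier) → ℤ → ℤ → Carrier
  rescale u β k n = u k ⁻¹ * u n ⁻¹ * β k n

  WeightedCocycle : (u : ℤ → Carrier) → (ℤ → ℤ → Carrier) → Set ℓ
  WeightedCocycle u β = ∀ k p q → u p * β q k + u q * β k p + u k * β p q ≈ 0#

  cyclic⇔weightedCocycle :
    ∀ {u c : ℤ → Carrier} {α β : ℤ → ℤ → Carrier} →
    (∀ n → c n ≉ 0#) → (∀ n p → α n p ≈ u p * c n) →
    (∀ n k p q → α n p * β q k + α n q * β k p + α n k * β p q ≈ 0#) ⇔ WeightedCocycle u β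
  cyclic⇔weightedCocycle {u} {c} {α} {β} c≉0 α≈uc = mk⇔
    (λ cyclic k p q → *-cancelˡ (c≉0 0ℤ)
      (trans (sym (factor 0ℤ k p q)) (trans (cyclic 0ℤ k p q) (sym (zeroʳ _)))))
    (λ weighted n k p q → trans (factor n k p q) (trans (*-congˡ (weighted k p q)) (zeroʳ _)))
    where
    factor : ∀ n k p q → α n p * β q k + α n q * β k p + α n k * β p q ≈
                         c n * (u p * β q k + u q * β k p + u k * β p q)
    factor n k p q = begin
      α n p * β q k + α n q * β k p + α n k * β p q
        ≈⟨ +-cong (+-cong (*-congʳ (α≈uc n p)) (*-congʳ (α≈uc n q))) (*-congʳ (α≈uc n k)) ⟩
      u p * c n * β q k + u q * c n * β k p + u k * c n * β p q
        ≈⟨ solve 7 (λ cn up uq uk a b d →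
                      up :* cn :* a :+ uq :* cn :* b :+ uk :* cn :* d :=
                      cn :* (up :* a :+ uq :* b :+ uk :* d))
                   refl (c n) (u p) (u q) (u k) (β q k) (β k p) (β p q) ⟩
      c n * (u p * β q k + u q * β k p + u k * β p q) ∎

  module _ {u : ℤ → Carrier} (u≉0 : ∀ n → u n ≉ 0#) where

    rescale-inverse : ∀ β k n → β k n ≈ u k * u n * rescale u β k n
    rescale-inverse β k n = begin
      β k n                                   ≈⟨ *-identityˡ _ ⟨
      1# * β k n                              ≈⟨ *-congʳ (*-identityˡ 1#) ⟨
      1# * 1# * β k n
        ≈⟨ *-congʳ (*-cong (inverseʳ _ (u≉0 k)) (inverseʳ _ (u≉0 n))) ⟨
      u k * u k ⁻¹ * (u n * u n ⁻¹) * β k n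
        ≈⟨ solve 5 (λ a a′ b b′ x → a :* a′ :* (b :* b′) :* x := a :* b :* (a′ :* b′ :* x))
                   refl (u k) (u k ⁻¹) (u n) (u n ⁻¹) (β k n) ⟩
      u k * u n * rescale u β k n ∎

    rescale-antisymmetric : ∀ {β} → Antisymmetric β → Antisymmetric (rescale u β)
    rescale-antisymmetric {β} antisym k n = begin
      u k ⁻¹ * u n ⁻¹ * β k n        ≈⟨ *-cong (*-comm _ _) (antisym k n) ⟩
      u n ⁻¹ * u k ⁻¹ * - β n k      ≈⟨ -‿distribʳ-* _ _ ⟨
      - (u n ⁻¹ * u k ⁻¹ * β n k)    ∎

    weightedCocycle⇔cocycle : ∀ β → WeightedCocycle u β ⇔ Cocycle (rescale u β)
    weightedCocycle⇔cocycle β = mk⇔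
      (λ weighted k p q → *-cancelˡ (*-≉0 (*-≉0 (u≉0 k) (u≉0 p)) (u≉0 q))
        (trans (sym (factor k p q)) (trans (weighted k p q) (sym (zeroʳ _)))))
      (λ cocycle k p q → trans (factor k p q) (trans (*-congˡ (cocycle k p q)) (zeroʳ _)))
      where
      γ : ℤ → ℤ → Carrier
      γ = rescale u β
      factor : ∀ k p q → u p * β q k + u q * β k p + u k * β p q ≈
                         u k * u p * u q * (γ q k + γ k p + γ p q)
      factor k p q = begin
        u p * β q k + u q * β k p + u k * β p q
          ≈⟨ +-cong (+-cong (*-congˡ (rescale-inverse β q k)) (*-congˡ (rescale-inverse β k p)))
                    (*-congˡ (rescale-inverse β p q)) ⟩
        u p * (u q * u k * γ q k) + u q * (u k * u p * γ k p) + u k * (u p * u q * γ p q)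
          ≈⟨ solve 6 (λ uk up uq a b c →
                        up :* (uq :* uk :* a) :+ uq :* (uk :* up :* b) :+ uk :* (up :* uq :* c) :=
                        uk :* up :* uq :* (a :+ b :+ c))
                     refl (u k) (u p) (u q) (γ q k) (γ k p) (γ p q) ⟩
        u k * u p * u q * (γ q k + γ k p + γ p q) ∎

  telescopicSum : (x t : ℤ → Carrier) → ℤ → ℤ → Carrier
  telescopicSum x t k n =
    sumRange F (λ i → t i * (prodRange F x (i ℤ.+ 1ℤ) n * (prodRange F x (k ℤ.+ 1ℤ) (i ℤ.- 1ℤ)) ⁻¹))
               (k ℤ.+ 1ℤ) n

  telescopes⇔telescopicSum :
    ∀ {x t : ℤ → Carrier} {β : ℤ → ℤ → Carrier} →
    (∀ n → x n ≉ 0#) → (∀ n → β (n ℤ.- 1ℤ) n ≈ t n) →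
    Telescopes (rescale (prodRange F x 1ℤ) β) ⇔
    (∀ k n → k ℤ.≤ n → β k n ≈ telescopicSum x t k n)
  telescopes⇔telescopicSum {x} {t} {β} x≉0 β≈t = mk⇔
    (λ telescopes k n k≤n → begin
      β k n                 ≈⟨ rescale-inverse X≉0 β k n ⟩
      X k * X n * γ k n     ≈⟨ *-congˡ (telescopes k n k≤n) ⟩
      X k * X n * S k n     ≈⟨ rescaled-sum k n ⟨
      telescopicSum x t k n ∎)
    (λ formula k n k≤n → *-cancelˡ (*-≉0 (X≉0 k) (X≉0 n)) (begin
      X k * X n * γ k n     ≈⟨ rescale-inverse X≉0 β k n ⟨
      β k n                 ≈⟨ formula k n k≤n ⟩
      telescopicSum x t k n ≈⟨ rescaled-sum k n ⟩
      X k * X n * S k n     ∎))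
    where
    X : ℤ → Carrier
    X = prodRange F x 1ℤ
    X≉0 : ∀ n → X n ≉ 0#
    X≉0 = prodRange-≉0 x≉0 1ℤ
    γ : ℤ → ℤ → Carrier
    γ = rescale X β
    d : ℤ → Carrier
    d i = γ (i ℤ.- 1ℤ) i
    S : ℤ → ℤ → Carrier
    S k n = sumRange F d (k ℤ.+ 1ℤ) n

    rescaled-term : ∀ k n i →
      t i * (prodRange F x (i ℤ.+ 1ℤ) n * (prodRange F x (k ℤ.+ 1ℤ) (i ℤ.- 1ℤ)) ⁻¹) ≈ X k * X n * d i
    rescaled-term k n i = begin
      t i * (A * B ⁻¹)
        ≈⟨ *-cong (trans (sym (β≈t i)) (rescale-inverse X≉0 β (i ℤ.- 1ℤ) i)) (*-cong A≈ B⁻¹≈) ⟩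
      X (i ℤ.- 1ℤ) * X i * d i * (X n * X i ⁻¹ * (X k * X (i ℤ.- 1ℤ) ⁻¹))
        ≈⟨ solve 7 (λ a a′ b b′ xk xn e →
                      a :* b :* e :* (xn :* b′ :* (xk :* a′)) := xk :* xn :* e :* (a :* a′ :* (b :* b′)))
                   refl (X (i ℤ.- 1ℤ)) (X (i ℤ.- 1ℤ) ⁻¹) (X i) (X i ⁻¹) (X k) (X n) (d i) ⟩
      X k * X n * d i * (X (i ℤ.- 1ℤ) * X (i ℤ.- 1ℤ) ⁻¹ * (X i * X i ⁻¹))
        ≈⟨ *-congˡ (trans (*-cong (inverseʳ _ (X≉0 (i ℤ.- 1ℤ))) (inverseʳ _ (X≉0 i)))
                          (*-identityˡ 1#)) ⟩
      X k * X n * d i * 1#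
        ≈⟨ *-identityʳ _ ⟩
      X k * X n * d i ∎
      where
      A B : Carrier
      A = prodRange F x (i ℤ.+ 1ℤ) n
      B = prodRange F x (k ℤ.+ 1ℤ) (i ℤ.- 1ℤ)
      A≈ : A ≈ X n * X i ⁻¹
      A≈ = x*y≈z⇒x≈z*y⁻¹ (X≉0 i) (trans (*-comm A (X i)) (prodRange-split x≉0 1ℤ i n))
      B⁻¹≈ : B ⁻¹ ≈ X k * X (i ℤ.- 1ℤ) ⁻¹
      B⁻¹≈ = x*y≈z⇒x⁻¹≈y*z⁻¹ (X≉0 (i ℤ.- 1ℤ)) (trans (*-comm B (X k))
                           (prodRange-split x≉0 1ℤ k (i ℤ.- 1ℤ)))

    rescaled-sum : ∀ k n → telescopicSum x t k n ≈ X k * X n * S k n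
    rescaled-sum k n =
      trans (sumRange-cong (rescaled-term k n) (k ℤ.+ 1ℤ) n) (sumRange-*ˡ (X k * X n) d (k ℤ.+ 1ℤ) n)

corollary3p6 : ∀ {c ℓ} (F : Field c ℓ) → let open Field F in
    (x y t : ℤ → Carrier) (α β : ℤ → ℤ → Carrier) →
    (∀ n → ¬ (x n ≈ 0#)) →
    (∀ n → ¬ (y n ≈ 0#)) →
    (∀ k n → α k n ≈ (prodRange F x 1ℤ n * (prodRange F y 1ℤ k) ⁻¹)) →
    (∀ n → β (n ℤ.- 1ℤ) n ≈ t n) →
    (∀ k n → β k n ≈ - β n k) →
    ((∀ n k p q →
        ((α n p * β q k) + (α n q * β k p)) + (α n k * β p q) ≈ 0#)
     → (∀ k n → k ℤ.≤ n →
        β k n ≈ sumRange F (λ i → t i * (prodRange F x (i ℤ.+ 1ℤ) n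
                                          * (prodRange F x (k ℤ.+ 1ℤ) (i ℤ.- 1ℤ)) ⁻¹))
                           (k ℤ.+ 1ℤ) n))
    × ((∀ k n → k ℤ.≤ n →
        β k n ≈ sumRange F (λ i → t i * (prodRange F x (i ℤ.+ 1ℤ) n
                                          * (prodRange F x (k ℤ.+ 1ℤ) (i ℤ.- 1ℤ)) ⁻¹))
                           (k ℤ.+ 1ℤ) n)
     → (∀ n k p q →
        ((α n p * β q k) + (α n q * β k p)) + (α n k * β p q) ≈ 0#))
corollary3p6 F x y t α β x≉0 y≉0 α≈XY⁻¹ β≈t antisym =
  < Equivalence.to , Equivalence.from >
    (⇔.trans (cyclic⇔weightedCocycle Y⁻¹≉0 α≈XY⁻¹)
    (⇔.trans (weightedCocycle⇔cocycle X≉0 β)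
    (⇔.trans (cocycle⇔telescopes (rescale-antisymmetric X≉0 antisym))
             (telescopes⇔telescopicSum x≉0 β≈t))))
  where
  open Field F hiding (zero)
  open FieldProperties F using (⁻¹-≉0)
  open Ranges F using (prodRange-≉0)
  open Cocycles F using (cocycle⇔telescopes)
  open Rescaling F

  X≉0 : ∀ n → prodRange F x 1ℤ n ≉ 0#
  X≉0 = prodRange-≉0 x≉0 1ℤ

  Y⁻¹≉0 : ∀ n → prodRange F y 1ℤ n ⁻¹ ≉ 0#
  Y⁻¹≉0 n = ⁻¹-≉0 (prodRange-≉0 y≉0 1ℤ n)
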